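{- Let $H=(\tilde V,E,|\cdot|)$ be a vertex-weighted forest such that $(\tilde V,E)$ is not a star. Then there is a vertex-weighted graph $H'=(\tilde V,E',|\cdot|)$ (same vertices and weights) such that $(\tilde V,E')$ is a star and $f_\pi(H')\geq f_\pi(H)$. Moreover, if $f_\pi(H')=f_\pi(H)$, then $|V|=|W|$, where $V$ is the center of the star $(\tilde V,E')$ and $W\in\tilde V$ is some vertex distinct from $V$.
   Context: A vertex-weighted graph is a triple $(\tilde V,E,|\cdot|)$ where $(\tilde V,E)$ is a graph and $|\cdot|:\tilde V\to\mathbb{N}^{>0}$. For such a graph, $f_\pi(\tilde V,E,|\cdot|)=\prod_{UV\in E}3^{|U||V|}\prod_{UV\in\binom{\tilde V}{2}\setminus E}2^{|U||V|}$. -}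

module Defs where

open import Data.Nat using (ℕ; zero; suc; _^_; _*_; _≤_; _<_)
open import Data.Bool using (Bool; true; false; if_then_else_)
open import Data.Fin using (Fin; toℕ; inject₁; fromℕ) renaming (zero to fzero; suc to fsuc)
open import Data.Fin.Properties using () renaming (_<?_ to _<ᶠ?_)
open import Data.List using (List; map; allFin)
open import Data.Nat.ListAction using (product)
open import Data.Product using (Σ; ∃; _×_; _,_)
open import Function.Definitions using (Injective)
open import Relation.Binary.PropositionalEquality using (_≡_; _≢_)
open import Relation.Nullary using (¬_; does)

record Graph (n : ℕ) : Set where
  field
    adj    : Fin n → Fin n → Bool
    symm   : ∀ i j → adj i j ≡ adj j i
    irrefl : ∀ i → adj i i ≡ false
open Graph public

PositiveWeights : ∀ {n} → (Fin n → ℕ) → Set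
PositiveWeights w = ∀ i → 0 < w i

record Cycle {n : ℕ} (G : Graph n) : Set where
  field
    k        : ℕ
    vert     : Fin (suc (suc (suc k))) → Fin n
    distinct : Injective _≡_ _≡_ vert
    step     : ∀ (i : Fin (suc (suc k))) → adj G (vert (inject₁ i)) (vert (fsuc i)) ≡ true
    close    : adj G (vert (fromℕ (suc (suc k)))) (vert fzero) ≡ true

IsForest : ∀ {n} → Graph n → Set
IsForest G = ¬ Cycle G

IsStarWithCenter : ∀ {n} → Graph n → Fin n → Set
IsStarWithCenter {n} G c =
  ∀ (i j : Fin n) → i ≢ j → (adj G i j ≡ true → (i ≡ c Data.Sum.⊎ j ≡ c)) × ((i ≡ c Data.Sum.⊎ j ≡ c) → adj G i j ≡ true)
  where import Data.Sum

IsStar : ∀ {n} → Graph n → Set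
IsStar {n} G = Σ (Fin n) λ c → IsStarWithCenter G c

pairProduct : ∀ {n} → (Fin n → Fin n → ℕ) → ℕ
pairProduct {n} g =
  product (map (λ i → product (map (λ j → if does (i <ᶠ? j) then g i j else 1) (allFin n))) (allFin n))

fπ : ∀ {n} → Graph n → (Fin n → ℕ) → ℕ
fπ G w = pairProduct (λ i j → (if adj G i j then 3 else 2) ^ (w i * w j))

-- With E(G) = Σ_{UV ∈ E} |U||V|, one has f_π(G) = f_π(∅) · (3/2)^E(G), so only E matters.
-- Let c be a vertex of maximum weight. Pruning leaves other than c gives every vertex of a
-- forest at most one parent (c none) such that each edge joins a vertex to its parent; hence
-- E(G) ≤ Σ_V |V||parent V| ≤ Σ_{V ≠ c} |V||c| = E(star centred at c). If G is not that star,
-- some V ≠ c has no parent or a parent W ≠ c, and the last inequality is strict unless |W| = |c|.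
module Submission where

open import Defs
open import Algebra.Properties.CommutativeMonoid.Sum as Sum using ()
open import Data.Bool using (Bool; true; false; if_then_else_; not; _∧_; _∨_; _xor_)
open import Data.Bool.Properties using (∨-comm; xor-comm; xor-same) renaming (_≟_ to _≟ᵇ_)
open import Data.Fin using (Fin; toℕ; inject₁; inject≤; fromℕ; opposite) renaming (zero to fzero; suc to fsuc)
open import Data.Fin.Properties as Fin using (_≟_; any?; ¬∀⟶∃¬; toℕ-injective)
open import Data.Vec.Functional using ([]; _∷_)
open import Data.List using (map; allFin; tabulate)
open import Data.List.Properties using (map-tabulate)
open import Data.Maybe using (Maybe; just; nothing; maybe′)
import Data.Maybe.Properties as Maybe
open import Data.Nat
  using (ℕ; zero; suc; _+_; _*_; _^_; _∸_; _≤_; _<_; _≥_; z≤n; s≤s; s≤s⁻¹; NonZero; >-nonZero; _≤?_)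
open import Data.Nat.Properties hiding (_≟_)
open import Data.Nat.Properties using () renaming (_≟_ to _≟ℕ_)
import Data.Nat.ListAction as List
open import Data.Product using (Σ; _×_; _,_; proj₁; proj₂)
open import Data.Sum using (_⊎_; inj₁; inj₂; [_,_]′)
open import Function using (_∘_; id; it; flip)
open import Function.Definitions using (Injective)
open import Algebra.Properties.CommutativeSemigroup *-commutativeSemigroup
  using () renaming (interchange to *-interchange)
open import Relation.Binary.PropositionalEquality
open import Relation.Binary.Definitions using (tri<; tri≈; tri>)
open import Relation.Nullary using (¬_; Dec; does; yes; no; ¬?; contradiction)
open import Relation.Nullary.Decidable using (dec-true; dec-false; decidable-stable; _×-dec_; _⊎-dec_)

open Sum +-0-commutativeMonoid using (sum; sum-syntax; sum-cong-≗; ∑-distrib-+; ∑-comm)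
open Sum *-1-commutativeMonoid using () renaming (sum to ∏; sum-cong-≗ to ∏-cong-≗)

∑-mono-≤ : ∀ {n} {f g : Fin n → ℕ} → (∀ i → f i ≤ g i) → sum f ≤ sum g
∑-mono-≤ {zero}  f≤g = z≤n
∑-mono-≤ {suc n} f≤g = +-mono-≤ (f≤g fzero) (∑-mono-≤ (f≤g ∘ fsuc))

∑-mono-< : ∀ {n} {f g : Fin n → ℕ} → (∀ i → f i ≤ g i) → ∀ k → f k < g k → sum f < sum g
∑-mono-< f≤g fzero    fk<gk = +-mono-<-≤ fk<gk (∑-mono-≤ (f≤g ∘ fsuc))
∑-mono-< f≤g (fsuc k) fk<gk = +-mono-≤-< (f≤g fzero) (∑-mono-< (f≤g ∘ fsuc) k fk<gk)

∑-δ : ∀ {n} (k : Fin n) (g : Fin n → ℕ) → ∑[ j < n ] (if does (k ≟ j) then g j else 0) ≡ g k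
∑-δ {suc n} fzero    g =
  trans (cong (g fzero +_) (Sum.sum-replicate-zero +-0-commutativeMonoid n)) (+-identityʳ (g fzero))
∑-δ {suc n} (fsuc k) g = ∑-δ k (g ∘ fsuc)

∏-nonZero : ∀ {n} (f : Fin n → ℕ) → (∀ i → NonZero (f i)) → NonZero (∏ f)
∏-nonZero {zero}  f f≢0 = _
∏-nonZero {suc n} f f≢0 =
  m*n≢0 (f fzero) (∏ (f ∘ fsuc)) {{f≢0 fzero}} {{∏-nonZero (f ∘ fsuc) (f≢0 ∘ fsuc)}}

∏-allFin : ∀ {n} (f : Fin n → ℕ) → List.product (map f (allFin n)) ≡ ∏ f
∏-allFin {n} f = trans (cong List.product (map-tabulate id f)) (product-tabulate f)
  where
  product-tabulate : ∀ {n} (f : Fin n → ℕ) → List.product (tabulate f) ≡ ∏ f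
  product-tabulate {zero}  f = refl
  product-tabulate {suc n} f = cong (f fzero *_) (product-tabulate (f ∘ fsuc))

half-≤ : ∀ {m n} → m + m ≤ n + n → m ≤ n
half-≤ {m} {n} m+m≤n+n with m ≤? n
... | yes m≤n = m≤n
... | no m≰n  = contradiction m+m≤n+n (<⇒≱ (+-mono-< (≰⇒> m≰n) (≰⇒> m≰n)))

half-≡ : ∀ {m n} → m + m ≡ n + n → m ≡ n
half-≡ eq = ≤-antisym (half-≤ (≤-reflexive eq)) (half-≤ (≤-reflexive (sym eq)))

-- Scaling by powers of 3/2

infix 4 _·[3/2]^_≡_
record _·[3/2]^_≡_ (K e a : ℕ) : Set where
  constructor scaling
  field scaling-eq : a * 2 ^ e ≡ K * 3 ^ e
open _·[3/2]^_≡_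

·[3/2]^-∏ : ∀ {n} {K e a : Fin n → ℕ} → (∀ i → K i ·[3/2]^ e i ≡ a i) → ∏ K ·[3/2]^ sum e ≡ ∏ a
·[3/2]^-∏ {zero}  eqs = scaling refl
·[3/2]^-∏ {suc n} {K} {e} {a} eqs = scaling (begin
  (a₀ * ∏ a′) * 2 ^ (e₀ + sum e′)       ≡⟨ cong ((a₀ * ∏ a′) *_) (^-distribˡ-+-* 2 e₀ (sum e′)) ⟩
  (a₀ * ∏ a′) * (2 ^ e₀ * 2 ^ sum e′)   ≡⟨ *-interchange a₀ (∏ a′) _ _ ⟩
  (a₀ * 2 ^ e₀) * (∏ a′ * 2 ^ sum e′)   ≡⟨ cong₂ _*_ (scaling-eq (eqs fzero)) (scaling-eq (·[3/2]^-∏ (eqs ∘ fsuc))) ⟩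
  (K₀ * 3 ^ e₀) * (∏ K′ * 3 ^ sum e′)   ≡⟨ *-interchange K₀ _ _ _ ⟩
  (K₀ * ∏ K′) * (3 ^ e₀ * 3 ^ sum e′)   ≡⟨ cong ((K₀ * ∏ K′) *_) (^-distribˡ-+-* 3 e₀ (sum e′)) ⟨
  (K₀ * ∏ K′) * 3 ^ (e₀ + sum e′)       ∎)
  where
  open ≡-Reasoning
  a₀ e₀ K₀ : ℕ
  a₀ = a fzero ; e₀ = e fzero ; K₀ = K fzero
  a′ e′ K′ : Fin n → ℕ
  a′ = a ∘ fsuc ; e′ = e ∘ fsuc ; K′ = K ∘ fsuc

·[3/2]^-if : ∀ b {K e a} → K ·[3/2]^ e ≡ a →
  (if b then K else 1) ·[3/2]^ (if b then e else 0) ≡ (if b then a else 1)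
·[3/2]^-if true  eq = eq
·[3/2]^-if false eq = scaling refl

·[3/2]^-edge : ∀ b x → 2 ^ x ·[3/2]^ (if b then x else 0) ≡ (if b then 3 else 2) ^ x
·[3/2]^-edge true  x = scaling (*-comm (3 ^ x) (2 ^ x))
·[3/2]^-edge false x = scaling refl

·[3/2]^-cancel : ∀ {K e a d b} → K ·[3/2]^ e ≡ a → K ·[3/2]^ (e + d) ≡ b → b * 2 ^ d ≡ a * 3 ^ d
·[3/2]^-cancel {K} {e} {a} {d} {b} (scaling eq) (scaling eq′) =
  *-cancelʳ-≡ (b * 2 ^ d) (a * 3 ^ d) (2 ^ e) {{m^n≢0 2 e}} (begin
    b * 2 ^ d * 2 ^ e       ≡⟨ *-assoc b _ _ ⟩
    b * (2 ^ d * 2 ^ e)     ≡⟨ cong (b *_) (trans (cong (2 ^_) (+-comm e d)) (^-distribˡ-+-* 2 d e)) ⟨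
    b * 2 ^ (e + d)         ≡⟨ eq′ ⟩
    K * 3 ^ (e + d)         ≡⟨ cong (K *_) (^-distribˡ-+-* 3 e d) ⟩
    K * (3 ^ e * 3 ^ d)     ≡⟨ *-assoc K _ _ ⟨
    K * 3 ^ e * 3 ^ d       ≡⟨ cong (_* 3 ^ d) eq ⟨
    a * 2 ^ e * 3 ^ d       ≡⟨ *-assoc a _ _ ⟩
    a * (2 ^ e * 3 ^ d)     ≡⟨ cong (a *_) (*-comm (2 ^ e) (3 ^ d)) ⟩
    a * (3 ^ d * 2 ^ e)     ≡⟨ *-assoc a _ _ ⟨
    a * 3 ^ d * 2 ^ e       ∎)
  where open ≡-Reasoning

·[3/2]^-mono-≤ : ∀ {K e e′ a b} → K ·[3/2]^ e ≡ a → K ·[3/2]^ e′ ≡ b → e ≤ e′ → a ≤ b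
·[3/2]^-mono-≤ {a = a} {b} eq eq′ e≤e′ with m≤n⇒∃[o]m+o≡n e≤e′
... | d , refl = *-cancelʳ-≤ a b (2 ^ d) {{m^n≢0 2 d}} (begin
  a * 2 ^ d   ≤⟨ *-monoʳ-≤ a (^-monoˡ-≤ d (n≤1+n 2)) ⟩
  a * 3 ^ d   ≡⟨ ·[3/2]^-cancel eq eq′ ⟨
  b * 2 ^ d   ∎)
  where open ≤-Reasoning

·[3/2]^-mono-< : ∀ {K e e′ a b} .{{_ : NonZero K}} → K ·[3/2]^ e ≡ a → K ·[3/2]^ e′ ≡ b → e < e′ → a < b
·[3/2]^-mono-< {K} {e} {a = a} {b} eq eq′ e<e′ with m≤n⇒∃[o]m+o≡n e<e′
... | d , refl = *-cancelʳ-< (2 ^ suc d) a b (begin-strict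
  a * 2 ^ suc d   <⟨ *-monoʳ-< a {{a≢0}} (^-monoˡ-< (suc d) (n<1+n 2)) ⟩
  a * 3 ^ suc d   ≡⟨ ·[3/2]^-cancel eq (subst (λ x → K ·[3/2]^ x ≡ b) (sym (+-suc e d)) eq′) ⟨
  b * 2 ^ suc d   ∎)
  where
  open ≤-Reasoning
  a≢0 : NonZero a
  a≢0 = m*n≢0⇒m≢0 a {{subst NonZero (sym (scaling-eq eq)) (m*n≢0 K (3 ^ e) {{it}} {{m^n≢0 3 e}})}}

_<ᵇ_ : ∀ {n} → Fin n → Fin n → Bool
i <ᵇ j = does (i Fin.<? j)

upperSum : ∀ {n} → (Fin n → Fin n → ℕ) → ℕ
upperSum {n} f = ∑[ i < n ] ∑[ j < n ] (if i <ᵇ j then f i j else 0)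

∑∑≡upperSum+upperSum : ∀ {n} (f : Fin n → Fin n → ℕ) → (∀ i → f i i ≡ 0) → (∀ i j → f i j ≡ f j i) →
  ∑[ i < n ] ∑[ j < n ] f i j ≡ upperSum f + upperSum f
∑∑≡upperSum+upperSum {n} f f-diag f-sym = begin
  ∑[ i < n ] ∑[ j < n ] f i j
    ≡⟨ sum-cong-≗ (λ i → sum-cong-≗ (split i)) ⟩
  ∑[ i < n ] ∑[ j < n ] (upper i j + lower i j)
    ≡⟨ sum-cong-≗ (λ i → ∑-distrib-+ (upper i) (lower i)) ⟩
  ∑[ i < n ] (∑[ j < n ] upper i j + ∑[ j < n ] lower i j)
    ≡⟨ ∑-distrib-+ (λ i → ∑[ j < n ] upper i j) (λ i → ∑[ j < n ] lower i j) ⟩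
  upperSum f + ∑[ i < n ] ∑[ j < n ] lower i j
    ≡⟨ cong (upperSum f +_) (∑-comm lower) ⟩
  upperSum f + ∑[ j < n ] ∑[ i < n ] lower i j
    ≡⟨ cong (upperSum f +_) (sum-cong-≗ (λ j → sum-cong-≗ (λ i → cong (if j <ᵇ i then_else 0) (f-sym i j)))) ⟩
  upperSum f + upperSum f ∎
  where
  open ≡-Reasoning
  upper lower : Fin n → Fin n → ℕ
  upper i j = if i <ᵇ j then f i j else 0
  lower i j = if j <ᵇ i then f i j else 0
  split : ∀ i j → f i j ≡ upper i j + lower i j
  split i j with Fin.<-cmp i j
  ... | tri< i<j _ j≮i rewrite dec-true (i Fin.<? j) i<j | dec-false (j Fin.<? i) j≮i = sym (+-identityʳ _)
  ... | tri> i≮j _ j<i rewrite dec-false (i Fin.<? j) i≮j | dec-true (j Fin.<? i) j<i = refl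
  ... | tri≈ i≮i refl _ rewrite dec-false (i Fin.<? i) i≮i = f-diag i

pairProduct≡∏∏ : ∀ {n} (g : Fin n → Fin n → ℕ) → pairProduct g ≡ ∏ (λ i → ∏ (λ j → if i <ᵇ j then g i j else 1))
pairProduct≡∏∏ {n} g = trans (∏-allFin row) (∏-cong-≗ (λ i → ∏-allFin (masked i)))
  where
  masked : Fin n → Fin n → ℕ
  masked i j = if i <ᵇ j then g i j else 1
  row : Fin n → ℕ
  row i = List.product (map (masked i) (allFin n))

edgeWeight : ∀ {n} → Graph n → (Fin n → ℕ) → Fin n → Fin n → ℕ
edgeWeight G w i j = if adj G i j then w i * w j else 0

totalEdgeWeight : ∀ {n} → Graph n → (Fin n → ℕ) → ℕ
totalEdgeWeight G w = upperSum (edgeWeight G w)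

fπ₀ : ∀ {n} → (Fin n → ℕ) → ℕ
fπ₀ w = pairProduct (λ i j → 2 ^ (w i * w j))

fπ-·[3/2]^ : ∀ {n} (G : Graph n) (w : Fin n → ℕ) → fπ₀ w ·[3/2]^ totalEdgeWeight G w ≡ fπ G w
fπ-·[3/2]^ G w = subst₂ (λ K a → K ·[3/2]^ totalEdgeWeight G w ≡ a)
  (sym (pairProduct≡∏∏ (λ i j → 2 ^ (w i * w j))))
  (sym (pairProduct≡∏∏ (λ i j → (if adj G i j then 3 else 2) ^ (w i * w j))))
  (·[3/2]^-∏ λ i → ·[3/2]^-∏ λ j → ·[3/2]^-if (i <ᵇ j) (·[3/2]^-edge (adj G i j) (w i * w j)))

fπ₀-nonZero : ∀ {n} (w : Fin n → ℕ) → NonZero (fπ₀ w)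
fπ₀-nonZero w = subst NonZero (sym (pairProduct≡∏∏ (λ i j → 2 ^ (w i * w j))))
  (∏-nonZero _ λ i → ∏-nonZero _ λ j → masked-nonZero (i <ᵇ j) (w i * w j))
  where
  masked-nonZero : ∀ b x → NonZero (if b then 2 ^ x else 1)
  masked-nonZero true  x = m^n≢0 2 x
  masked-nonZero false x = _

module _ {n} (G H : Graph n) (w : Fin n → ℕ) where

  fπ-mono-≤ : totalEdgeWeight G w ≤ totalEdgeWeight H w → fπ G w ≤ fπ H w
  fπ-mono-≤ = ·[3/2]^-mono-≤ (fπ-·[3/2]^ G w) (fπ-·[3/2]^ H w)

  fπ-mono-< : totalEdgeWeight G w < totalEdgeWeight H w → fπ G w < fπ H w
  fπ-mono-< = ·[3/2]^-mono-< {{fπ₀-nonZero w}} (fπ-·[3/2]^ G w) (fπ-·[3/2]^ H w)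

edgeWeight-diag : ∀ {n} (G : Graph n) w i → edgeWeight G w i i ≡ 0
edgeWeight-diag G w i rewrite irrefl G i = refl

edgeWeight-sym : ∀ {n} (G : Graph n) w i j → edgeWeight G w i j ≡ edgeWeight G w j i
edgeWeight-sym G w i j rewrite symm G i j = cong (if adj G j i then_else 0) (*-comm (w i) (w j))

∑∑edgeWeight≡totalEdgeWeight+totalEdgeWeight : ∀ {n} (G : Graph n) w →
  ∑[ i < n ] ∑[ j < n ] edgeWeight G w i j ≡ totalEdgeWeight G w + totalEdgeWeight G w
∑∑edgeWeight≡totalEdgeWeight+totalEdgeWeight G w =
  ∑∑≡upperSum+upperSum (edgeWeight G w) (edgeWeight-diag G w) (edgeWeight-sym G w)

-- Parent maps and the star

record ParentMap {n} (G : Graph n) (r : Fin n) : Set where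
  field
    parent          : Fin n → Maybe (Fin n)
    parent-root     : parent r ≡ nothing
    parent-adjacent : ∀ {i j} → parent i ≡ just j → adj G i j ≡ true
    edge-to-parent  : ∀ {i j} → adj G i j ≡ true → parent i ≡ just j ⊎ parent j ≡ just i

module _ {n} (w : Fin n → ℕ) (parent : Fin n → Maybe (Fin n)) where

  parentWeight : Fin n → ℕ
  parentWeight i = maybe′ (λ k → w i * w k) 0 (parent i)

  parentEdgeWeight : Fin n → Fin n → ℕ
  parentEdgeWeight i j = maybe′ (λ k → if does (k ≟ j) then w i * w j else 0) 0 (parent i)

  ∑parentEdgeWeight : ∀ i → ∑[ j < n ] parentEdgeWeight i j ≡ parentWeight i
  ∑parentEdgeWeight i with parent i
  ... | nothing = Sum.sum-replicate-zero +-0-commutativeMonoid n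
  ... | just k  = ∑-δ k (λ j → w i * w j)

  ∑∑parentEdgeWeight-symmetrised : ∑[ i < n ] ∑[ j < n ] (parentEdgeWeight i j + parentEdgeWeight j i)
                          ≡ sum parentWeight + sum parentWeight
  ∑∑parentEdgeWeight-symmetrised = begin
    ∑[ i < n ] ∑[ j < n ] (parentEdgeWeight i j + parentEdgeWeight j i)
      ≡⟨ sum-cong-≗ (λ i → ∑-distrib-+ (parentEdgeWeight i) (λ j → parentEdgeWeight j i)) ⟩
    ∑[ i < n ] (∑[ j < n ] parentEdgeWeight i j + ∑[ j < n ] parentEdgeWeight j i)
      ≡⟨ ∑-distrib-+ (λ i → ∑[ j < n ] parentEdgeWeight i j) (λ i → ∑[ j < n ] parentEdgeWeight j i) ⟩
    ∑[ i < n ] ∑[ j < n ] parentEdgeWeight i j + ∑[ i < n ] ∑[ j < n ] parentEdgeWeight j i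
      ≡⟨ cong (∑[ i < n ] ∑[ j < n ] parentEdgeWeight i j +_) (∑-comm (λ i j → parentEdgeWeight j i)) ⟩
    ∑[ i < n ] ∑[ j < n ] parentEdgeWeight i j + ∑[ j < n ] ∑[ i < n ] parentEdgeWeight j i
      ≡⟨ cong₂ _+_ (sum-cong-≗ ∑parentEdgeWeight) (sum-cong-≗ ∑parentEdgeWeight) ⟩
    sum parentWeight + sum parentWeight ∎
    where open ≡-Reasoning

module _ {n} {G : Graph n} {r : Fin n} (P : ParentMap G r) (w : Fin n → ℕ) where
  open ParentMap P

  edgeWeight-≤-parentEdgeWeight : ∀ i j →
    edgeWeight G w i j ≤ parentEdgeWeight w parent i j + parentEdgeWeight w parent j i
  edgeWeight-≤-parentEdgeWeight i j with adj G i j in ij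
  ... | false = z≤n
  ... | true with edge-to-parent ij
  ...   | inj₁ pi≡j rewrite pi≡j | dec-true (j ≟ j) refl = m≤m+n _ _
  ...   | inj₂ pj≡i rewrite pj≡i | dec-true (i ≟ i) refl =
          ≤-trans (≤-reflexive (*-comm (w i) (w j))) (m≤n+m _ _)

  totalEdgeWeight-≤-∑parentWeight : totalEdgeWeight G w ≤ sum (parentWeight w parent)
  totalEdgeWeight-≤-∑parentWeight = half-≤ (begin
    totalEdgeWeight G w + totalEdgeWeight G w
      ≡⟨ ∑∑edgeWeight≡totalEdgeWeight+totalEdgeWeight G w ⟨
    ∑[ i < n ] ∑[ j < n ] edgeWeight G w i j
      ≤⟨ ∑-mono-≤ (λ i → ∑-mono-≤ (edgeWeight-≤-parentEdgeWeight i)) ⟩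
    ∑[ i < n ] ∑[ j < n ] (parentEdgeWeight w parent i j + parentEdgeWeight w parent j i)
      ≡⟨ ∑∑parentEdgeWeight-symmetrised w parent ⟩
    sum (parentWeight w parent) + sum (parentWeight w parent) ∎)
    where open ≤-Reasoning

star : ∀ {n} → Fin n → Graph n
adj    (star c) i j = does (i ≟ c) xor does (j ≟ c)
symm   (star c) i j = xor-comm (does (i ≟ c)) (does (j ≟ c))
irrefl (star c) i   = xor-same (does (i ≟ c))

star-isStarWithCenter : ∀ {n} (c : Fin n) → IsStarWithCenter (star c) c
star-isStarWithCenter c i j i≢j = adjacent⇒central , central⇒adjacent
  where
  adjacent⇒central : adj (star c) i j ≡ true → i ≡ c ⊎ j ≡ c
  adjacent⇒central ij with i ≟ c | j ≟ c
  ... | yes i≡c | _       = inj₁ i≡c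
  ... | no _    | yes j≡c = inj₂ j≡c
  central⇒adjacent : i ≡ c ⊎ j ≡ c → adj (star c) i j ≡ true
  central⇒adjacent (inj₁ refl) rewrite dec-true (i ≟ i) refl | dec-false (j ≟ i) (i≢j ∘ sym) = refl
  central⇒adjacent (inj₂ refl) rewrite dec-false (i ≟ j) i≢j | dec-true (j ≟ j) refl = refl

toCenter : ∀ {n} → Fin n → Fin n → Maybe (Fin n)
toCenter c i = if does (i ≟ c) then nothing else just c

module _ {n} (w : Fin n → ℕ) (c : Fin n) where

  edgeWeight-star : ∀ i j →
    edgeWeight (star c) w i j ≡ parentEdgeWeight w (toCenter c) i j + parentEdgeWeight w (toCenter c) j i
  edgeWeight-star i j with i ≟ c | j ≟ c
  ... | yes refl | yes refl = refl
  ... | yes refl | no _  rewrite dec-true (i ≟ i) refl = *-comm (w i) (w j)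
  ... | no _  | yes refl rewrite dec-true (j ≟ j) refl = sym (+-identityʳ _)
  ... | no i≢c | no j≢c rewrite dec-false (c ≟ j) (j≢c ∘ sym) | dec-false (c ≟ i) (i≢c ∘ sym) = refl

  totalEdgeWeight-star : totalEdgeWeight (star c) w ≡ sum (parentWeight w (toCenter c))
  totalEdgeWeight-star = half-≡ (begin
    totalEdgeWeight (star c) w + totalEdgeWeight (star c) w
      ≡⟨ ∑∑edgeWeight≡totalEdgeWeight+totalEdgeWeight (star c) w ⟨
    ∑[ i < n ] ∑[ j < n ] edgeWeight (star c) w i j
      ≡⟨ sum-cong-≗ (λ i → sum-cong-≗ (edgeWeight-star i)) ⟩
    ∑[ i < n ] ∑[ j < n ] (parentEdgeWeight w (toCenter c) i j + parentEdgeWeight w (toCenter c) j i)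
      ≡⟨ ∑∑parentEdgeWeight-symmetrised w (toCenter c) ⟩
    sum (parentWeight w (toCenter c)) + sum (parentWeight w (toCenter c)) ∎)
    where open ≡-Reasoning

  module _ (w-max : ∀ i → w i ≤ w c) (parent : Fin n → Maybe (Fin n)) (parent-c : parent c ≡ nothing) where

    parentWeight-≤-toCenter : ∀ i → parentWeight w parent i ≤ parentWeight w (toCenter c) i
    parentWeight-≤-toCenter i with i ≟ c
    ... | yes refl rewrite parent-c = z≤n
    ... | no _ with parent i
    ...   | nothing = z≤n
    ...   | just k  = *-monoʳ-≤ (w i) (w-max k)

    parentWeight-<-toCenter : ∀ i → i ≢ c → 0 < w i → (∀ k → parent i ≡ just k → w k < w c) →
      parentWeight w parent i < parentWeight w (toCenter c) i
    parentWeight-<-toCenter i i≢c 0<wi lighter rewrite dec-false (i ≟ c) i≢c with parent i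
    ... | nothing = *-mono-≤ 0<wi (<-≤-trans 0<wi (w-max i))
    ... | just k  = *-monoʳ-< (w i) {{>-nonZero 0<wi}} (lighter k refl)

module _ {n} {G : Graph n} {c : Fin n} (P : ParentMap G c) where
  open ParentMap P

  parentsCentral⇒isStarWithCenter : (∀ i → i ≢ c → parent i ≡ just c) → IsStarWithCenter G c
  parentsCentral⇒isStarWithCenter central i j i≢j = adjacent⇒central , central⇒adjacent
    where
    adjacent⇒central : adj G i j ≡ true → i ≡ c ⊎ j ≡ c
    adjacent⇒central ij with edge-to-parent ij | i ≟ c | j ≟ c
    ... | _         | yes i≡c | _       = inj₁ i≡c
    ... | _         | no _    | yes j≡c = inj₂ j≡c
    ... | inj₁ pi≡j | no i≢c  | no _    = inj₂ (Maybe.just-injective (trans (sym pi≡j) (central i i≢c)))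
    ... | inj₂ pj≡i | no _    | no j≢c  = inj₁ (Maybe.just-injective (trans (sym pj≡i) (central j j≢c)))
    central⇒adjacent : i ≡ c ⊎ j ≡ c → adj G i j ≡ true
    central⇒adjacent (inj₁ refl) = trans (symm G i j) (parent-adjacent (central j (i≢j ∘ sym)))
    central⇒adjacent (inj₂ refl) = parent-adjacent (central i i≢j)

  ¬isStar⇒noncentralParent : ¬ IsStar G → Σ (Fin n) λ i → i ≢ c × parent i ≢ just c
  ¬isStar⇒noncentralParent ¬star with ¬∀⟶∃¬ n (λ i → i ≡ c ⊎ parent i ≡ just c)
      (λ i → (i ≟ c) ⊎-dec Maybe.≡-dec _≟_ (parent i) (just c))
      (λ all → ¬star (c , parentsCentral⇒isStarWithCenter (λ i i≢c → [ flip contradiction i≢c , id ]′ (all i))))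
  ... | i , ¬i = i , ¬i ∘ inj₁ , ¬i ∘ inj₂

  module _ (w : Fin n → ℕ) (w-max : ∀ i → w i ≤ w c) where

    parentWeight-≤ : ∀ i → parentWeight w parent i ≤ parentWeight w (toCenter c) i
    parentWeight-≤ = parentWeight-≤-toCenter w c w-max parent parent-root

    totalEdgeWeight-≤-star : totalEdgeWeight G w ≤ totalEdgeWeight (star c) w
    totalEdgeWeight-≤-star = begin
      totalEdgeWeight G w                ≤⟨ totalEdgeWeight-≤-∑parentWeight P w ⟩
      sum (parentWeight w parent)        ≤⟨ ∑-mono-≤ parentWeight-≤ ⟩
      sum (parentWeight w (toCenter c))  ≡⟨ totalEdgeWeight-star w c ⟨
      totalEdgeWeight (star c) w         ∎
      where open ≤-Reasoning

    totalEdgeWeight-<-star : PositiveWeights w → (∀ k → k ≢ c → w k < w c) → ¬ IsStar G →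
      totalEdgeWeight G w < totalEdgeWeight (star c) w
    totalEdgeWeight-<-star w>0 others-lighter ¬star with ¬isStar⇒noncentralParent ¬star
    ... | i , i≢c , pi≢c = begin-strict
      totalEdgeWeight G w                ≤⟨ totalEdgeWeight-≤-∑parentWeight P w ⟩
      sum (parentWeight w parent)        <⟨ ∑-mono-< parentWeight-≤ i parentWeight-< ⟩
      sum (parentWeight w (toCenter c))  ≡⟨ totalEdgeWeight-star w c ⟨
      totalEdgeWeight (star c) w         ∎
      where
      open ≤-Reasoning
      lighter : ∀ k → parent i ≡ just k → w k < w c
      lighter k pi≡k = others-lighter k λ { refl → pi≢c pi≡k }
      parentWeight-< : parentWeight w parent i < parentWeight w (toCenter c) i
      parentWeight-< = parentWeight-<-toCenter w c w-max parent parent-root i i≢c (w>0 i) lighter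

-- Paths and leaves in forests

opposite-injective : ∀ {n} → Injective _≡_ _≡_ (opposite {n})
opposite-injective {n} {i} {j} oi≡oj = begin
  i                       ≡⟨ Fin.opposite-involutive i ⟨
  opposite (opposite i)   ≡⟨ cong opposite oi≡oj ⟩
  opposite (opposite j)   ≡⟨ Fin.opposite-involutive j ⟩
  j                       ∎
  where open ≡-Reasoning

toℕ-opposite-step : ∀ {n} (a b : Fin n) → toℕ b ≡ suc (toℕ a) → toℕ (opposite a) ≡ suc (toℕ (opposite b))
toℕ-opposite-step {n} a b b≡1+a = begin
  toℕ (opposite a)                 ≡⟨ Fin.opposite-prop a ⟩
  n ∸ suc (toℕ a)                  ≡⟨⟩
  suc n ∸ suc (suc (toℕ a))        ≡⟨ +-∸-assoc 1 (subst (_< n) b≡1+a (Fin.toℕ<n b)) ⟩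
  suc (n ∸ suc (suc (toℕ a)))      ≡⟨ cong (λ t → suc (n ∸ suc t)) b≡1+a ⟨
  suc (n ∸ suc (toℕ b))            ≡⟨ cong suc (Fin.opposite-prop b) ⟨
  suc (toℕ (opposite b))           ∎
  where open ≡-Reasoning

module _ {n} (G : Graph n) where

  Consecutive : ∀ {m} → (Fin m → Fin n) → Set
  Consecutive v = ∀ a b → toℕ b ≡ suc (toℕ a) → adj G (v a) (v b) ≡ true

  record Path (m : ℕ) : Set where
    field
      vertex           : Fin (suc (suc m)) → Fin n
      vertex-injective : Injective _≡_ _≡_ vertex
      consecutive      : Consecutive vertex
  open Path

  adjacent⇒≢ : ∀ {a b} → adj G a b ≡ true → a ≢ b
  adjacent⇒≢ {a} ab refl = contradiction (trans (sym ab) (irrefl G a)) λ ()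

  edgePath : ∀ {a b} → adj G a b ≡ true → Path 0
  vertex (edgePath {a} {b} ab) = a ∷ b ∷ []
  vertex-injective (edgePath ab) {fzero}      {fzero}      _  = refl
  vertex-injective (edgePath ab) {fzero}      {fsuc fzero} eq = contradiction eq (adjacent⇒≢ ab)
  vertex-injective (edgePath ab) {fsuc fzero} {fzero}      eq = contradiction (sym eq) (adjacent⇒≢ ab)
  vertex-injective (edgePath ab) {fsuc fzero} {fsuc fzero} _  = refl
  consecutive (edgePath ab) fzero (fsuc fzero) _ = ab

  reverse : ∀ {m} → Path m → Path m
  vertex (reverse P) = vertex P ∘ opposite
  vertex-injective (reverse P) = opposite-injective ∘ vertex-injective P
  consecutive (reverse P) a b b≡1+a =
    trans (symm G _ _) (consecutive P (opposite b) (opposite a) (toℕ-opposite-step a b b≡1+a))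

  extend : ∀ {m} (P : Path m) x → adj G x (vertex P fzero) ≡ true → (∀ a → vertex P a ≢ x) → Path (suc m)
  vertex (extend P x _ _) = x ∷ vertex P
  vertex-injective (extend P x _ x∉P) {fzero}  {fzero}  _  = refl
  vertex-injective (extend P x _ x∉P) {fzero}  {fsuc b} eq = contradiction (sym eq) (x∉P b)
  vertex-injective (extend P x _ x∉P) {fsuc a} {fzero}  eq = contradiction eq (x∉P a)
  vertex-injective (extend P x _ x∉P) {fsuc a} {fsuc b} eq = cong fsuc (vertex-injective P eq)
  consecutive (extend P x x~P _) fzero    (fsuc fzero) _ = x~P
  consecutive (extend P x _ _)   (fsuc a) (fsuc b) b≡1+a = consecutive P a b (suc-injective b≡1+a)

  chord⇒cycle : ∀ {m} (P : Path m) (s : Fin m) → adj G (vertex P fzero) (vertex P (fsuc (fsuc s))) ≡ true → Cycle G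
  chord⇒cycle {m} P s chord = record
    { k        = toℕ s
    ; vert     = vertex P ∘ prefix
    ; distinct = Fin.inject≤-injective _ _ _ _ ∘ vertex-injective P
    ; step     = λ i → consecutive P _ _ (prefix-step i)
    ; close    = trans (symm G _ _) (subst (λ t → adj G (vertex P fzero) (vertex P t) ≡ true)
                                           (sym prefix-last) chord)
    }
    where
    prefix : Fin (3 + toℕ s) → Fin (2 + m)
    prefix i = inject≤ i (s≤s (s≤s (Fin.toℕ<n s)))
    toℕ-prefix : ∀ i → toℕ (prefix i) ≡ toℕ i
    toℕ-prefix i = Fin.toℕ-inject≤ i _
    prefix-step : ∀ i → toℕ (prefix (fsuc i)) ≡ suc (toℕ (prefix (inject₁ i)))
    prefix-step i = begin
      toℕ (prefix (fsuc i))            ≡⟨ toℕ-prefix (fsuc i) ⟩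
      suc (toℕ i)                      ≡⟨ cong suc (Fin.toℕ-inject₁ i) ⟨
      suc (toℕ (inject₁ i))            ≡⟨ cong suc (toℕ-prefix (inject₁ i)) ⟨
      suc (toℕ (prefix (inject₁ i)))   ∎
      where open ≡-Reasoning
    prefix-last : prefix (fromℕ (2 + toℕ s)) ≡ fsuc (fsuc s)
    prefix-last = toℕ-injective (trans (toℕ-prefix _) (Fin.toℕ-fromℕ _))

  LeafWithNeighbour : Fin n → Fin n → Set
  LeafWithNeighbour v u = adj G v u ≡ true × (∀ j → adj G v j ≡ true → j ≡ u)

  leaf-or-branch : ∀ v u → (∀ j → adj G v j ≡ true → j ≡ u) ⊎ Σ (Fin n) λ x → adj G v x ≡ true × x ≢ u
  leaf-or-branch v u with any? (λ x → (adj G v x ≟ᵇ true) ×-dec ¬? (x ≟ u))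
  ... | yes branch = inj₂ branch
  ... | no ¬branch = inj₁ λ j vj → decidable-stable (j ≟ u) (λ j≢u → ¬branch (j , vj , j≢u))

  module _ (forest : IsForest G) (c : Fin n) where

    -- The path is extended at its head until the head is a leaf, and reversed whenever
    -- the new head is c. Acyclicity keeps it a path, so it runs out of room within n steps.
    walkToLeaf : ∀ {m} fuel → n ≤ fuel + m → (P : Path m) → vertex P fzero ≢ c →
      Σ (Fin n) λ v → v ≢ c × Σ (Fin n) (LeafWithNeighbour v)
    walkToLeaf {m} zero n≤m P _ =
      contradiction (≤-trans (n≤1+n (suc m)) (≤-trans (Fin.injective⇒≤ (vertex-injective P)) n≤m)) 1+n≰n
    walkToLeaf {m} (suc fuel) n≤fuel+1+m P head≢c with leaf-or-branch (vertex P fzero) (vertex P (fsuc fzero))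
    ... | inj₁ only = _ , head≢c , _ , consecutive P fzero (fsuc fzero) refl , only
    ... | inj₂ (x , head~x , x≢second) with any? (λ a → vertex P a ≟ x)
    ...   | yes (fzero , head≡x) = contradiction head≡x (adjacent⇒≢ head~x)
    ...   | yes (fsuc fzero , second≡x) = contradiction (sym second≡x) x≢second
    ...   | yes (fsuc (fsuc s) , P[2+s]≡x) =
            contradiction (chord⇒cycle P s (subst (λ t → adj G _ t ≡ true) (sym P[2+s]≡x) head~x)) forest
    ...   | no x∉P = continue (x ≟ c)
      where
      Q : Path (suc m)
      Q = extend P x (trans (symm G _ _) head~x) (λ a P[a]≡x → x∉P (a , P[a]≡x))
      n≤fuel+2+m : n ≤ fuel + suc m
      n≤fuel+2+m = ≤-trans n≤fuel+1+m (≤-reflexive (sym (+-suc fuel m)))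
      continue : Dec (x ≡ c) → Σ (Fin n) λ v → v ≢ c × Σ (Fin n) (LeafWithNeighbour v)
      continue (no x≢c)  = walkToLeaf fuel n≤fuel+2+m Q x≢c
      continue (yes x≡c) =
        walkToLeaf fuel n≤fuel+2+m (reverse Q) λ last≡c → x∉P (fromℕ (suc m) , trans last≡c (sym x≡c))

    leafAvoiding : ∀ {a b} → adj G a b ≡ true → Σ (Fin n) λ v → v ≢ c × Σ (Fin n) (LeafWithNeighbour v)
    leafAvoiding {a} {b} ab with a ≟ c
    ... | no a≢c   = walkToLeaf n (≤-reflexive (sym (+-identityʳ n))) (edgePath ab) a≢c
    ... | yes refl =
      walkToLeaf n (≤-reflexive (sym (+-identityʳ n))) (edgePath (trans (symm G b a) ab)) (adjacent⇒≢ ab ∘ sym)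

-- Pruning a forest into a parent map

isolate : ∀ {n} → Graph n → Fin n → Graph n
adj    (isolate G v) i j = adj G i j ∧ not (does (i ≟ v) ∨ does (j ≟ v))
symm   (isolate G v) i j =
  cong₂ (λ e incident → e ∧ not incident) (symm G i j) (∨-comm (does (i ≟ v)) (does (j ≟ v)))
irrefl (isolate G v) i rewrite irrefl G i = refl

module _ {n} (G : Graph n) (v : Fin n) where

  isolate-⊆ : ∀ {i j} → adj (isolate G v) i j ≡ true → adj G i j ≡ true
  isolate-⊆ {i} {j} ij with adj G i j
  ... | true = refl

  isolate-keeps : ∀ {i j} → i ≢ v → j ≢ v → adj G i j ≡ true → adj (isolate G v) i j ≡ true
  isolate-keeps {i} {j} i≢v j≢v ij rewrite ij | dec-false (i ≟ v) i≢v | dec-false (j ≟ v) j≢v = refl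

IsForest-⊆ : ∀ {n} {G H : Graph n} → (∀ {i j} → adj H i j ≡ true → adj G i j ≡ true) → IsForest G → IsForest H
IsForest-⊆ H⊆G forest cycle = forest record
  { k = k ; vert = vert ; distinct = distinct ; step = H⊆G ∘ step ; close = H⊆G close }
  where open Cycle cycle

edgeCount : ∀ {n} → Graph n → ℕ
edgeCount {n} G = ∑[ i < n ] ∑[ j < n ] (if adj G i j then 1 else 0)

edgeCount-isolate : ∀ {n} {G : Graph n} {v u} → adj G v u ≡ true → edgeCount (isolate G v) < edgeCount G
edgeCount-isolate {G = G} {v} {u} vu = ∑-mono-< (λ i → ∑-mono-≤ (fewer i)) v (∑-mono-< (fewer v) u vu-removed)
  where
  fewer : ∀ i j → (if adj (isolate G v) i j then 1 else 0) ≤ (if adj G i j then 1 else 0)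
  fewer i j with adj G i j
  ... | false = z≤n
  ... | true with not (does (i ≟ v) ∨ does (j ≟ v))
  ...   | true  = ≤-refl
  ...   | false = z≤n
  vu-removed : (if adj (isolate G v) v u then 1 else 0) < (if adj G v u then 1 else 0)
  vu-removed rewrite vu | dec-true (v ≟ v) refl = ≤-refl

module _ {n} {G : Graph n} {c : Fin n} where

  edgelessParentMap : (∀ i j → adj G i j ≢ true) → ParentMap G c
  edgelessParentMap edgeless = record
    { parent = λ _ → nothing ; parent-root = refl
    ; parent-adjacent = λ () ; edge-to-parent = λ {i} {j} ij → contradiction ij (edgeless i j) }

  adoptLeaf : ∀ {v u} → LeafWithNeighbour G v u → v ≢ c → ParentMap (isolate G v) c → ParentMap G c
  adoptLeaf {v} {u} (vu , only-u) v≢c P = record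
    { parent = parent′ ; parent-root = parent′-root
    ; parent-adjacent = parent′-adjacent ; edge-to-parent = edge-to-parent′ }
    where
    open ParentMap P
    parent′ : Fin n → Maybe (Fin n)
    parent′ i = if does (i ≟ v) then just u else parent i
    parent′-root : parent′ c ≡ nothing
    parent′-root rewrite dec-false (c ≟ v) (v≢c ∘ sym) = parent-root
    parent′-adjacent : ∀ {i j} → parent′ i ≡ just j → adj G i j ≡ true
    parent′-adjacent {i} pi≡j with i ≟ v | pi≡j
    ... | yes refl | refl = vu
    ... | no _     | pi≡j = isolate-⊆ G v (parent-adjacent pi≡j)
    edge-to-parent′ : ∀ {i j} → adj G i j ≡ true → parent′ i ≡ just j ⊎ parent′ j ≡ just i
    edge-to-parent′ {i} {j} ij with i ≟ v | j ≟ v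
    ... | yes refl | _        = inj₁ (cong just (sym (only-u j ij)))
    ... | no _     | yes refl = inj₂ (cong just (sym (only-u i (trans (symm G v i) ij))))
    ... | no i≢v   | no j≢v   = edge-to-parent (isolate-keeps G v i≢v j≢v ij)

forest⇒parentMapᶠ : ∀ {n} fuel (G : Graph n) → edgeCount G < fuel → IsForest G → (c : Fin n) → ParentMap G c
forest⇒parentMapᶠ (suc fuel) G count<fuel forest c with any? (λ a → any? (λ b → adj G a b ≟ᵇ true))
... | no ¬edge = edgelessParentMap λ a b ab → ¬edge (a , b , ab)
... | yes (a , b , ab) with leafAvoiding G forest c ab
...   | v , v≢c , u , leaf = adoptLeaf leaf v≢c
        (forest⇒parentMapᶠ fuel (isolate G v)
          (<-≤-trans (edgeCount-isolate {G = G} (proj₁ leaf)) (s≤s⁻¹ count<fuel))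
          (IsForest-⊆ (isolate-⊆ G v) forest) c)

forest⇒parentMap : ∀ {n} {G : Graph n} → IsForest G → (c : Fin n) → ParentMap G c
forest⇒parentMap {G = G} = forest⇒parentMapᶠ (suc (edgeCount G)) G ≤-refl

argmax : ∀ {n} (w : Fin (suc n) → ℕ) → Σ (Fin (suc n)) λ c → ∀ i → w i ≤ w c
argmax {zero}  w = fzero , λ { fzero → ≤-refl }
argmax {suc n} w with argmax (w ∘ fsuc)
... | c , tail≤ with w fzero ≤? w (fsuc c)
...   | yes head≤ = fsuc c , λ { fzero → head≤ ; (fsuc i) → tail≤ i }
...   | no head≰  = fzero  , λ { fzero → ≤-refl ; (fsuc i) → ≤-trans (tail≤ i) (≰⇒≥ head≰) }

lemma5p13 : (n : ℕ) (G : Graph (suc n)) (w : Fin (suc n) → ℕ) →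
    PositiveWeights w → IsForest G → ¬ IsStar G →
    Σ (Graph (suc n)) λ G' → Σ (Fin (suc n)) λ c →
      IsStarWithCenter G' c × fπ G' w ≥ fπ G w ×
      (fπ G' w ≡ fπ G w → Σ (Fin (suc n)) λ W → W ≢ c × w c ≡ w W)
lemma5p13 n G w w>0 forest ¬star =
  star c , c , star-isStarWithCenter c , fπ-mono-≤ G (star c) w (totalEdgeWeight-≤-star P w w-max) , tie
  where
  c : Fin (suc n)
  c = proj₁ (argmax w)
  w-max : ∀ i → w i ≤ w c
  w-max = proj₂ (argmax w)
  P : ParentMap G c
  P = forest⇒parentMap forest c
  tie : fπ (star c) w ≡ fπ G w → Σ (Fin (suc n)) λ W → W ≢ c × w c ≡ w W
  tie fπ-equal with any? (λ W → ¬? (W ≟ c) ×-dec (w c ≟ℕ w W))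
  ... | yes found = found
  ... | no ¬found =
    contradiction fπ-equal (>⇒≢ (fπ-mono-< G (star c) w (totalEdgeWeight-<-star P w w-max w>0 lighter ¬star)))
    where
    lighter : ∀ k → k ≢ c → w k < w c
    lighter k k≢c = ≤∧≢⇒< (w-max k) λ wk≡wc → ¬found (k , k≢c , sym wk≡wc)
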